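{- Let $S[1:n]$ be a sequence of distinct real numbers and $k\ge3$. For every $1\le x\le n$, \[\mathsf{inc}'[x]=\max\{\mathsf{dec}[i]+M'[i-1,x]-1 : i\in Z(1,x)\}\] (with $\mathsf{inc}'[x]=0$ if $Z(1,x)$ is empty), and \[\mathsf{inc}[x]=\max\{\mathsf{inc}'[x],\,M'[0,x]\}.\]
   Context: $S[a:b]$ denotes the contiguous subsequence $(S[a],\dots,S[b])$; subsequences need not be contiguous. A run is a maximal contiguous subsequence that is increasing or decreasing; a $k$-rollercoaster is a sequence every run of which has length at least $k$. For $1\le x\le n$, $\mathsf{inc}[x]$ (respectively $\mathsf{dec}[x]$) is the length of a longest subsequence of $S[1:x]$ that is a $k$-rollercoaster with last run increasing (respectively decreasing), not necessarily containing $S[x]$ (taken to be $0$ if none exists). $M$ is the $(n+1)\times(n+1)$ matrix with rows and columns indexed $0,\dots,n$, where $M[i,j]$ is the length of a longest increasing subsequence of $S[i+1:j]$ if $i<j$ and $M[i,j]=j-i$ otherwise; $M'$ is obtained from $M$ by replacing every entry less than $k$ by $-\infty$. For $j\le j'$, $Z(j,j')$ is the set of indices $i$ with $j\le i\le j'$ such that the longest increasing subsequence of $S[i:j']$ has length at least $k$ (equivalently $M'[i-1,j']\ne-\infty$). -}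

module Defs where

open import Level using (Level)
open import Data.Bool using (Bool; true; false; _∧_; _∨_; not; if_then_else_)
open import Data.Nat using (ℕ; zero; suc; _∸_; _⊔_; _≤ᵇ_; _<ᵇ_; _≡ᵇ_)
open import Data.Integer using (ℤ; +_; -[1+_]) renaming (_+_ to _+ℤ_; _-_ to _-ℤ_; _≤ᵇ_ to _≤ℤᵇ_; _⊔_ to _⊔ℤ_)
open import Data.List using (List; []; _∷_; length; map; take; drop; foldr; upTo; filter; _++_)
open import Data.Bool.ListAction using (all; any)
open import Data.Maybe using (Maybe; just; nothing)
open import Relation.Nullary.Decidable using (⌊_⌋)
open import Relation.Binary.Bundles using (StrictTotalOrder)

sublists : ∀ {a} {A : Set a} → List A → List (List A)
sublists []       = [] ∷ []
sublists (x ∷ xs) = let r = sublists xs in map (x ∷_) r ++ r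

range : ℕ → ℕ → List ℕ
range a b = map (λ t → a Data.Nat.+ t) (upTo (b ∸ a))

_‼_ : ∀ {a} {A : Set a} → List A → ℕ → Maybe A
[]       ‼ _       = nothing
(x ∷ xs) ‼ zero    = just x
(x ∷ xs) ‼ (suc n) = xs ‼ n

data ℤ∞ : Set where
  -∞  : ℤ∞
  fin : ℤ → ℤ∞

infixl 6 _⊕_
_⊕_ : ℤ∞ → ℤ∞ → ℤ∞
-∞    ⊕ _     = -∞
fin _ ⊕ -∞    = -∞
fin x ⊕ fin y = fin (x +ℤ y)

max∞ : ℤ∞ → ℤ∞ → ℤ∞
max∞ -∞      y       = y
max∞ (fin x) -∞      = fin x
max∞ (fin x) (fin y) = fin (x ⊔ℤ y)

-- maximum of a nonempty list (−∞ for the empty list; only used on nonempty lists)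
maxList : List ℤ∞ → ℤ∞
maxList = foldr max∞ -∞

module Seq {a ℓ₁ ℓ₂} (O : StrictTotalOrder a ℓ₁ ℓ₂) (k : ℕ) where
  open StrictTotalOrder O renaming (Carrier to A)

  -- ys[i] < ys[j] (0-based positions; false if out of range)
  lt : List A → ℕ → ℕ → Bool
  lt ys i j with ys ‼ i | ys ‼ j
  ... | just u | just v = ⌊ u <? v ⌋
  ... | _      | _      = false

  increasing : List A → Bool
  increasing ys = all (λ t → lt ys t (suc t)) (range 0 (length ys ∸ 1))

  longest : (List A → Bool) → List A → ℕ
  longest p xs = foldr (λ ys m → if p ys then length ys ⊔ m else m) 0 (sublists xs)

  LIS : List A → ℕ
  LIS = longest increasing

  -- contiguous segment ys[a..b] (0-based, inclusive) is increasing / decreasing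
  incSeg decSeg monoSeg : List A → ℕ → ℕ → Bool
  incSeg  ys a b = all (λ t → lt ys t (suc t)) (range a b)
  decSeg  ys a b = all (λ t → lt ys (suc t) t) (range a b)
  monoSeg ys a b = incSeg ys a b ∨ decSeg ys a b

  -- ys[a..b] is a run: a maximal (w.r.t. inclusion) contiguous
  -- subsequence that is increasing or decreasing
  isRun : List A → ℕ → ℕ → Bool
  isRun ys a b =
    (a ≤ᵇ b) ∧ (b <ᵇ length ys) ∧ monoSeg ys a b ∧
    all (λ a' → all (λ b' →
           not ((a' ≤ᵇ a) ∧ (b ≤ᵇ b') ∧ monoSeg ys a' b')
           ∨ ((a' ≡ᵇ a) ∧ (b' ≡ᵇ b)))
         (upTo (length ys)))
        (upTo (length ys))

  rollercoaster : List A → Bool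
  rollercoaster ys =
    all (λ a → all (λ b → not (isRun ys a b) ∨ (k ≤ᵇ suc (b ∸ a)))
                   (upTo (length ys)))
        (upTo (length ys))

  lastRunInc lastRunDec : List A → Bool
  lastRunInc ys = any (λ a → isRun ys a (length ys ∸ 1) ∧ incSeg ys a (length ys ∸ 1))
                      (upTo (length ys))
  lastRunDec ys = any (λ a → isRun ys a (length ys ∸ 1) ∧ decSeg ys a (length ys ∸ 1))
                      (upTo (length ys))

  -- inc[x], dec[x] for the sequence S (positions 1..n); S[1:x] = take x S
  inc dec : List A → ℕ → ℕ
  inc S x = longest (λ ys → rollercoaster ys ∧ lastRunInc ys) (take x S)
  dec S x = longest (λ ys → rollercoaster ys ∧ lastRunDec ys) (take x S)

  -- M[i,j]: LIS of S[i+1:j] if i < j, and j - i otherwise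
  M : List A → ℕ → ℕ → ℤ
  M S i j = if i <ᵇ j then + LIS (drop i (take j S)) else (+ j) -ℤ (+ i)

  M' : List A → ℕ → ℕ → ℤ∞
  M' S i j = if M S i j ≤ℤᵇ (+ k -ℤ + 1) then -∞ else fin (M S i j)

  Z : List A → ℕ → ℕ → List ℕ
  Z S j j' = filter (λ i → k Data.Nat.≤? LIS (drop (i ∸ 1) (take j' S))) (range j (suc j'))

  inc' : List A → ℕ → ℤ∞
  inc' S x with Z S 1 x
  ... | [] = fin (+ 0)
  ... | is = maxList (map (λ i → fin (+ dec S i) ⊕ M' S (i ∸ 1) x ⊕ fin -[1+ 0 ]) is)

-- A longest k-rollercoaster R in S[1:x] ending with an increasing run is either a single increasing
-- run, of length at most M'[0,x], or its last run starts at a turn S[i]. Cutting R at S[i] yields a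
-- k-rollercoaster in S[1:i] ending with a decreasing run and an increasing subsequence of S[i:x] of
-- length at least k, sharing S[i]; hence |R| ≤ dec[i] + M'[i-1,x] - 1 with i ∈ Z(1,x). Conversely,
-- such a rollercoaster and such an increasing subsequence, sharing at most S[i], glue to a k-rollercoaster
-- ending with an increasing run: as the values are distinct, every step goes strictly up or down, and the
-- junction either prolongs the decreasing run or starts the increasing one, so no run gets shorter than k.

module Submission where

open import Defs
open import Level using (Level)
open import Data.Bool using (Bool; true; false; _∧_; _∨_; not; if_then_else_; T)
open import Data.Bool.Properties using (T?; T-∧; T-∨)
open import Data.Bool.ListAction using (all; any)
open import Data.Empty using (⊥-elim)
open import Data.Unit using (tt)
open import Data.Nat using (ℕ; zero; suc; _+_; _∸_; _⊔_; _≤ᵇ_; _<ᵇ_; _≡ᵇ_; _≤_; _<_; z≤n; s≤s; _≤?_; _<?_)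
open import Data.Nat.Properties
open import Data.Integer using (+_; -[1+_]; +≤+) renaming (_≤_ to _≤ℤ_; _≤ᵇ_ to _≤ℤᵇ_; _-_ to _-ℤ_)
import Data.Integer.Properties as ℤ
open import Data.List using (List; []; _∷_; length; map; take; drop; foldr; upTo; _++_)
open import Data.List.Properties using (length-++; length-take; length-drop; take-take; ++-assoc)
open import Data.List.Membership.Propositional using (_∈_; find; lose)
open import Data.List.Membership.Propositional.Properties
  using (∈-map⁺; ∈-map⁻; ∈-upTo⁺; ∈-upTo⁻; ∈-++⁺ˡ; ∈-++⁺ʳ; ∈-++⁻; ∈-filter⁺; ∈-filter⁻)
open import Data.List.Relation.Unary.All as All using (All; []; _∷_)
open import Data.List.Relation.Unary.All.Properties using (all⁺; all⁻)
open import Data.List.Relation.Unary.Any using (here; there)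
open import Data.List.Relation.Unary.Any.Properties using (any⁺; any⁻)
open import Data.List.Relation.Unary.AllPairs using (AllPairs; []; _∷_)
open import Data.List.Relation.Unary.Unique.Setoid using (Unique)
open import Data.List.Relation.Binary.Sublist.Propositional using (_⊆_; []; _∷_; _∷ʳ_; ⊆-trans)
open import Data.List.Relation.Binary.Sublist.Propositional.Properties using (take-⊆; drop-⊆; All-resp-⊆)
open import Data.Maybe using (Maybe; just; nothing)
open import Data.Product using (∃-syntax; _×_; _,_; proj₁; proj₂)
open import Data.Sum using (_⊎_; inj₁; inj₂; [_,_])
open import Function using (_∘_; _⇔_; mk⇔; Equivalence)
open Equivalence using (to; from)
open import Relation.Binary using (Rel)
open import Relation.Binary.Bundles using (StrictTotalOrder)
open import Relation.Binary.Definitions using (tri<; tri≈; tri>)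
open import Relation.Binary.PropositionalEquality hiding ([_])
open import Relation.Nullary using (¬_; yes; no; Dec)
open import Relation.Nullary.Reflects using (ofʸ; ofⁿ)
open import Relation.Nullary.Decidable using (⌊_⌋; toWitness; fromWitness; map′)

private variable
  ℓ ℓ′ : Level
  X : Set ℓ

‼-take : ∀ m (xs : List X) {i} → i < m → take m xs ‼ i ≡ xs ‼ i
‼-take (suc m) []       _              = refl
‼-take (suc m) (x ∷ xs) {zero}  _      = refl
‼-take (suc m) (x ∷ xs) {suc i} (s≤s h) = ‼-take m xs h

length-take-≤ : ∀ {m} (xs : List X) → m ≤ length xs → length (take m xs) ≡ m
length-take-≤ {m = m} xs m≤ = trans (length-take m xs) (m≤n⇒m⊓n≡m m≤)

‼-++ˡ : ∀ (xs ys : List X) {i} → i < length xs → (xs ++ ys) ‼ i ≡ xs ‼ i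
‼-++ˡ (x ∷ xs) ys {zero}  _       = refl
‼-++ˡ (x ∷ xs) ys {suc i} (s≤s h) = ‼-++ˡ xs ys h

‼-++ʳ : ∀ (xs ys : List X) i → (xs ++ ys) ‼ (length xs + i) ≡ ys ‼ i
‼-++ʳ []       ys i = refl
‼-++ʳ (x ∷ xs) ys i = ‼-++ʳ xs ys i

‼-drop : ∀ p (xs : List X) i → drop p xs ‼ i ≡ xs ‼ (p + i)
‼-drop zero    xs       i = refl
‼-drop (suc p) []       i = refl
‼-drop (suc p) (x ∷ xs) i = ‼-drop p xs i

∈-range⁺ : ∀ {a b t} → a ≤ t → t < b → t ∈ range a b
∈-range⁺ {a} {b} a≤t t<b =
  subst (_∈ range a b) (m+[n∸m]≡n a≤t) (∈-map⁺ (λ u → a + u) (∈-upTo⁺ (∸-monoˡ-< t<b a≤t)))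

∈-range⁻ : ∀ {a b t} → t ∈ range a b → a ≤ t × t < b
∈-range⁻ {a} {b} t∈ with ∈-map⁻ (λ u → a + u) t∈
... | u , u∈ , refl = m≤m+n a u , (begin-strict
  a + u        <⟨ +-monoʳ-< a u<b∸a ⟩
  a + (b ∸ a)  ≡⟨ m+[n∸m]≡n {a} (<⇒≤ (m∸n≢0⇒n<m λ b∸a≡0 → n≮0 (subst (u <_) b∸a≡0 u<b∸a))) ⟩
  b            ∎)
  where
  open ≤-Reasoning
  u<b∸a = ∈-upTo⁻ u∈

T-→ : ∀ {x y} → T (not x ∨ y) ⇔ (T x → T y)
T-→ {true}  = mk⇔ (λ ty _ → ty) (λ f → f tt)
T-→ {false} = mk⇔ (λ _ ()) (λ _ → tt)

all-range⇔ : ∀ (p : ℕ → Bool) {a b} → T (all p (range a b)) ⇔ (∀ t → a ≤ t → t < b → T (p t))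
all-range⇔ p = mk⇔
  (λ h t a≤t t<b → All.lookup (all⁺ p _ h) (∈-range⁺ a≤t t<b))
  (λ h → all⁻ p (All.tabulate λ t∈ → let a≤t , t<b = ∈-range⁻ t∈ in h _ a≤t t<b))

all-upTo⇔ : ∀ (p : ℕ → Bool) {n} → T (all p (upTo n)) ⇔ (∀ t → t < n → T (p t))
all-upTo⇔ p = mk⇔
  (λ h t t<n → All.lookup (all⁺ p _ h) (∈-upTo⁺ t<n))
  (λ h → all⁻ p (All.tabulate λ t∈ → h _ (∈-upTo⁻ t∈)))

any-upTo⇔ : ∀ (p : ℕ → Bool) {n} → T (any p (upTo n)) ⇔ (∃[ t ] t < n × T (p t))
any-upTo⇔ p = mk⇔
  (λ h → let t , t∈ , pt = find (any⁻ p _ h) in t , ∈-upTo⁻ t∈ , pt)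
  (λ (t , t<n , pt) → any⁺ p (lose (∈-upTo⁺ t<n) pt))

⊆⇒∈-sublists : ∀ {ys xs : List X} → ys ⊆ xs → ys ∈ sublists xs
⊆⇒∈-sublists []                       = here refl
⊆⇒∈-sublists {xs = x ∷ xs} (x ∷ʳ σ)   = ∈-++⁺ʳ (map (x ∷_) (sublists xs)) (⊆⇒∈-sublists σ)
⊆⇒∈-sublists               (refl ∷ σ) = ∈-++⁺ˡ (∈-map⁺ (_ ∷_) (⊆⇒∈-sublists σ))

∈-sublists⇒⊆ : ∀ {ys : List X} xs → ys ∈ sublists xs → ys ⊆ xs
∈-sublists⇒⊆ []       (here refl) = []
∈-sublists⇒⊆ (x ∷ xs) ys∈ with ∈-++⁻ (map (x ∷_) (sublists xs)) ys∈
... | inj₂ ys∈′ = x ∷ʳ ∈-sublists⇒⊆ xs ys∈′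
... | inj₁ ys∈′ with ∈-map⁻ (x ∷_) ys∈′
...   | zs , zs∈ , refl = refl ∷ ∈-sublists⇒⊆ xs zs∈

AllPairs-resp-⊆ : ∀ {R : Rel X ℓ′} {xs ys} → xs ⊆ ys → AllPairs R ys → AllPairs R xs
AllPairs-resp-⊆ []         []         = []
AllPairs-resp-⊆ (y ∷ʳ σ)   (_ ∷ rys)  = AllPairs-resp-⊆ σ rys
AllPairs-resp-⊆ (refl ∷ σ) (ry ∷ rys) = All-resp-⊆ σ ry ∷ AllPairs-resp-⊆ σ rys

-- r is the position in xs of the element ys[p].
⊆-split : ∀ {ys xs : List X} → ys ⊆ xs → ∀ {p} → p < length ys →
  ∃[ r ] r < length xs × take (suc p) ys ⊆ take (suc r) xs × drop p ys ⊆ drop r xs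
⊆-split (x ∷ʳ σ) p<
  with r , r< , σˡ , σʳ ← ⊆-split σ p<
  = suc r , s≤s r< , x ∷ʳ σˡ , σʳ
⊆-split (refl ∷ σ) {zero}  _ = zero , s≤s z≤n , refl ∷ [] , refl ∷ σ
⊆-split (refl ∷ σ) {suc p} (s≤s p<)
  with r , r< , σˡ , σʳ ← ⊆-split σ p<
  = suc r , s≤s r< , refl ∷ σˡ , σʳ

-- Both pieces may use the element at position r; then it is the last of ys and the first of zs.
⊆-join : ∀ (xs : List X) r {ys zs} → ys ⊆ take (suc r) xs → zs ⊆ drop r xs →
  ys ++ zs ⊆ xs ⊎ ∃[ ys₀ ] ∃[ zs₀ ] ∃[ s ] ys ≡ ys₀ ++ s ∷ [] × zs ≡ s ∷ zs₀ × ys ++ zs₀ ⊆ xs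
⊆-join []       zero    []              []         = inj₁ []
⊆-join []       (suc r) []              []         = inj₁ []
⊆-join (x ∷ xs) zero    (x ∷ʳ [])       σ          = inj₁ σ
⊆-join (x ∷ xs) zero    (refl ∷ [])     (x ∷ʳ σ)   = inj₁ (refl ∷ σ)
⊆-join (x ∷ xs) zero    (refl ∷ [])     (refl ∷ σ) = inj₂ ([] , _ , x , refl , refl , refl ∷ σ)
⊆-join (x ∷ xs) (suc r) (x ∷ʳ τ)        σ with ⊆-join xs r τ σ
... | inj₁ ρ                                = inj₁ (x ∷ʳ ρ)
... | inj₂ (ys₀ , zs₀ , s , e₁ , e₂ , ρ)   = inj₂ (ys₀ , zs₀ , s , e₁ , e₂ , x ∷ʳ ρ)
⊆-join (x ∷ xs) (suc r) (refl ∷ τ)      σ with ⊆-join xs r τ σ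
... | inj₁ ρ                                = inj₁ (refl ∷ ρ)
... | inj₂ (ys₀ , zs₀ , s , e₁ , e₂ , ρ)   = inj₂ (x ∷ ys₀ , zs₀ , s , cong (x ∷_) e₁ , e₂ , refl ∷ ρ)

module _ (p : List X → Bool) where

  longestAmong : List (List X) → ℕ
  longestAmong = foldr (λ ys m → if p ys then length ys ⊔ m else m) 0

  longestAmong-≥ : ∀ {ys} Ls → ys ∈ Ls → T (p ys) → length ys ≤ longestAmong Ls
  longestAmong-≥ (ys ∷ Ls) (here refl) pys with p ys
  ... | true = m≤m⊔n _ _
  longestAmong-≥ (zs ∷ Ls) (there ys∈) pys with p zs
  ... | true  = ≤-trans (longestAmong-≥ Ls ys∈ pys) (m≤n⊔m _ _)
  ... | false = longestAmong-≥ Ls ys∈ pys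

  longestAmong-attained : ∀ Ls → 0 < longestAmong Ls →
    ∃[ ys ] ys ∈ Ls × T (p ys) × length ys ≡ longestAmong Ls
  longestAmong-attained (zs ∷ Ls) pos with p zs in pzs
  ... | false with ys , ys∈ , pys , len ← longestAmong-attained Ls pos = ys , there ys∈ , pys , len
  ... | true with ≤-total (longestAmong Ls) (length zs)
  ...   | inj₁ ≤zs = zs , here refl , subst T (sym pzs) tt , sym (m≥n⇒m⊔n≡m ≤zs)
  ...   | inj₂ zs≤ with ys , ys∈ , pys , len ← longestAmong-attained Ls (subst (0 <_) (m≤n⇒m⊔n≡n zs≤) pos)
          = ys , there ys∈ , pys , trans len (sym (m≤n⇒m⊔n≡n zs≤))

suc-∸1 : ∀ {n} → 0 < n → suc (n ∸ 1) ≡ n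
suc-∸1 {suc n} _ = refl

∸1< : ∀ {n} → 0 < n → n ∸ 1 < n
∸1< pos = ≤-reflexive (suc-∸1 pos)

0<∸⇒< : ∀ {m n} → 0 < n ∸ m → m < n
0<∸⇒< pos = m∸n≢0⇒n<m λ n∸m≡0 → <-irrefl (sym n∸m≡0) pos

<∸1⇒suc< : ∀ {t n} → t < n ∸ 1 → suc t < n
<∸1⇒suc< {n = suc n} t< = s≤s t<

<⇒≡suc : ∀ {m n} → m < n → ∃[ s ] suc s ≡ n × m ≤ s
<⇒≡suc (s≤s m≤s) = _ , refl , m≤s

infix 4 _≤∞_
data _≤∞_ : ℤ∞ → ℤ∞ → Set where
  -∞≤_    : ∀ y → -∞ ≤∞ y
  fin≤fin : ∀ {i j} → i ≤ℤ j → fin i ≤∞ fin j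

≤∞-refl : ∀ {x} → x ≤∞ x
≤∞-refl { -∞}   = -∞≤ -∞
≤∞-refl {fin i} = fin≤fin ℤ.≤-refl

≤∞-trans : ∀ {x y z} → x ≤∞ y → y ≤∞ z → x ≤∞ z
≤∞-trans (-∞≤ _)     _           = -∞≤ _
≤∞-trans (fin≤fin p) (fin≤fin q) = fin≤fin (ℤ.≤-trans p q)

≤∞-antisym : ∀ {x y} → x ≤∞ y → y ≤∞ x → x ≡ y
≤∞-antisym (-∞≤ _)     (-∞≤ _)     = refl
≤∞-antisym (fin≤fin p) (fin≤fin q) = cong fin (ℤ.≤-antisym p q)

max∞-lub : ∀ {x y z} → x ≤∞ z → y ≤∞ z → max∞ x y ≤∞ z
max∞-lub (-∞≤ _)     y≤z         = y≤z
max∞-lub (fin≤fin p) (-∞≤ _)     = fin≤fin p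
max∞-lub (fin≤fin p) (fin≤fin q) = fin≤fin (ℤ.⊔-lub p q)

max∞-upperˡ : ∀ x y → x ≤∞ max∞ x y
max∞-upperˡ -∞      y       = -∞≤ y
max∞-upperˡ (fin i) -∞      = ≤∞-refl
max∞-upperˡ (fin i) (fin j) = fin≤fin (ℤ.i≤i⊔j i j)

max∞-upperʳ : ∀ x y → y ≤∞ max∞ x y
max∞-upperʳ -∞      y       = ≤∞-refl
max∞-upperʳ (fin i) -∞      = -∞≤ _
max∞-upperʳ (fin i) (fin j) = fin≤fin (ℤ.i≤j⊔i i j)

≤-max∞ : ∀ {x y z} → z ≤∞ x ⊎ z ≤∞ y → z ≤∞ max∞ x y
≤-max∞ {x} {y} = [ (λ z≤x → ≤∞-trans z≤x (max∞-upperˡ x y)) , (λ z≤y → ≤∞-trans z≤y (max∞-upperʳ x y)) ]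

maxList-lub : ∀ (f : X → ℤ∞) xs {z} → (∀ {x} → x ∈ xs → f x ≤∞ z) → maxList (map f xs) ≤∞ z
maxList-lub f []       bound = -∞≤ _
maxList-lub f (x ∷ xs) bound = max∞-lub (bound (here refl)) (maxList-lub f xs (bound ∘ there))

maxList-upper : ∀ (f : X → ℤ∞) {xs x} → x ∈ xs → f x ≤∞ maxList (map f xs)
maxList-upper f {y ∷ ys} (here refl) = max∞-upperˡ (f y) _
maxList-upper f {y ∷ ys} (there x∈) = ≤∞-trans (maxList-upper f x∈) (max∞-upperʳ (f y) _)

data Dir : Set where
  ↑ ↓ : Dir

opposite : Dir → Dir
opposite ↑ = ↓
opposite ↓ = ↑

opposite-≢ : ∀ {d} → opposite d ≢ d
opposite-≢ {↑} ()
opposite-≢ {↓} ()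

module Runs {o ℓ₁ ℓ₂} (O : StrictTotalOrder o ℓ₁ ℓ₂) (k : ℕ) where
  open StrictTotalOrder O using (compare) renaming (Carrier to A; _<?_ to _<ₐ?_; asym to <ₐ-asym)
  open Seq O k

  ltMaybe : Maybe A → Maybe A → Bool
  ltMaybe (just u) (just v) = ⌊ u <ₐ? v ⌋
  ltMaybe _        _        = false

  lt-‼ : ∀ ys i j → lt ys i j ≡ ltMaybe (ys ‼ i) (ys ‼ j)
  lt-‼ ys i j with ys ‼ i | ys ‼ j
  ... | just _  | just _  = refl
  ... | just _  | nothing = refl
  ... | nothing | _       = refl

  lt-asym : ∀ ys i j → T (lt ys i j) → ¬ T (lt ys j i)
  lt-asym ys i j rewrite lt-‼ ys i j | lt-‼ ys j i = asym (ys ‼ i) (ys ‼ j)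
    where
    asym : ∀ u v → T (ltMaybe u v) → ¬ T (ltMaybe v u)
    asym (just u) (just v) u<v v<u = <ₐ-asym (toWitness u<v) (toWitness v<u)

  data Step : Dir → List A → ℕ → Set o where
    up   : ∀ {ys t} → T (lt ys t (suc t)) → Step ↑ ys t
    down : ∀ {ys t} → T (lt ys (suc t) t) → Step ↓ ys t

  lt-cong : ∀ ys zs i j i′ j′ → ys ‼ i ≡ zs ‼ i′ → ys ‼ j ≡ zs ‼ j′ → lt ys i j ≡ lt zs i′ j′
  lt-cong ys zs i j i′ j′ eᵢ eⱼ = trans (lt-‼ ys i j) (trans (cong₂ ltMaybe eᵢ eⱼ) (sym (lt-‼ zs i′ j′)))

  step-cong : ∀ {d ys zs t u} → ys ‼ t ≡ zs ‼ u → ys ‼ suc t ≡ zs ‼ suc u → Step d ys t → Step d zs u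
  step-cong {ys = ys} {zs} {t} {u} e e′ (up s)   = up   (subst T (lt-cong ys zs t (suc t) u (suc u) e e′) s)
  step-cong {ys = ys} {zs} {t} {u} e e′ (down s) = down (subst T (lt-cong ys zs (suc t) t (suc u) u e′ e) s)

  step-asym : ∀ {d ys t} → Step d ys t → ¬ Step (opposite d) ys t
  step-asym {ys = ys} {t} (up s)   (down s′) = lt-asym ys t (suc t) s s′
  step-asym {ys = ys} {t} (down s) (up s′)   = lt-asym ys (suc t) t s s′

  step-dir-unique : ∀ {d e ys t} → Step d ys t → Step e ys t → d ≡ e
  step-dir-unique (up _)     (up _)     = refl
  step-dir-unique (down _)   (down _)   = refl
  step-dir-unique s@(up _)   s′@(down _) = ⊥-elim (step-asym s s′)
  step-dir-unique s@(down _) s′@(up _)   = ⊥-elim (step-asym s s′)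

  step-asymʳ : ∀ {d ys t} → Step (opposite d) ys t → ¬ Step d ys t
  step-asymʳ s s′ = opposite-≢ (step-dir-unique s s′)

  stepᵇ : Dir → List A → ℕ → Bool
  stepᵇ ↑ ys t = lt ys t (suc t)
  stepᵇ ↓ ys t = lt ys (suc t) t

  step⇔ : ∀ d {ys t} → T (stepᵇ d ys t) ⇔ Step d ys t
  step⇔ ↑ = mk⇔ up   λ { (up s)   → s }
  step⇔ ↓ = mk⇔ down λ { (down s) → s }

  step? : ∀ d ys t → Dec (Step d ys t)
  step? d ys t = map′ (to (step⇔ d)) (from (step⇔ d)) (T? (stepᵇ d ys t))

  Seg : Dir → List A → ℕ → ℕ → Set o
  Seg d ys a b = ∀ t → a ≤ t → t < b → Step d ys t

  Mono : List A → ℕ → ℕ → Set o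
  Mono ys a b = ∃[ d ] Seg d ys a b

  Monotone : Dir → List A → Set o
  Monotone d ys = Seg d ys 0 (length ys ∸ 1)

  seg-shrink : ∀ {d ys a b a′ b′} → Seg d ys a b → a ≤ a′ → b′ ≤ b → Seg d ys a′ b′
  seg-shrink seg a≤ ≤b t a′≤t t<b′ = seg t (≤-trans a≤ a′≤t) (<-≤-trans t<b′ ≤b)

  seg-stepˡ : ∀ {d ys t b} → Step d ys t → Seg d ys (suc t) b → Seg d ys t b
  seg-stepˡ st seg u t≤u u<b with m≤n⇒m<n∨m≡n t≤u
  ... | inj₁ t<u  = seg u t<u u<b
  ... | inj₂ refl = st

  seg-stepʳ : ∀ {d ys a b} → Seg d ys a b → Step d ys b → Seg d ys a (suc b)
  seg-stepʳ seg st u a≤u u<sb with m≤n⇒m<n∨m≡n (≤-pred u<sb)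
  ... | inj₁ u<b  = seg u a≤u u<b
  ... | inj₂ refl = st

  seg-single : ∀ {d ys t} → Step d ys t → Seg d ys t (suc t)
  seg-single st = seg-stepˡ st (λ _ st≤u u<st → ⊥-elim (<-irrefl refl (≤-<-trans st≤u u<st)))

  seg-extendˡ : ∀ d {ys} a {b} → Seg d ys a b →
    ∃[ q ] q ≤ a × Seg d ys q b × (∀ {t} → suc t ≡ q → ¬ Step d ys t)
  seg-extendˡ d zero    seg = zero , z≤n , seg , λ ()
  seg-extendˡ d {ys} (suc a) seg with step? d ys a
  ... | yes st with q , q≤a , seg′ , stuck ← seg-extendˡ d a (seg-stepˡ st seg)
        = q , m≤n⇒m≤1+n q≤a , seg′ , stuck
  ... | no ¬st = suc a , ≤-refl , seg , λ { refl → ¬st }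

  record Run (ys : List A) (a b : ℕ) : Set o where
    field
      start≤end  : a ≤ b
      end<length : b < length ys
      mono       : Mono ys a b
      maximal    : ∀ {a′ b′} → b′ < length ys → a′ ≤ a → b ≤ b′ → Mono ys a′ b′ → a′ ≡ a × b′ ≡ b

  Rollercoaster : List A → Set o
  Rollercoaster ys = ∀ {a b} → Run ys a b → k ≤ suc (b ∸ a)

  LastRun : Dir → List A → Set o
  LastRun d ys = ∃[ a ] Run ys a (length ys ∸ 1) × Seg d ys a (length ys ∸ 1)

  run-intro : ∀ {d ys a b} → a < b → b < length ys → Seg d ys a b →
    (∀ {t} → suc t ≡ a → ¬ Step d ys t) → (suc b < length ys → ¬ Step d ys b) → Run ys a b
  run-intro {d} {ys} {a} {b} a<b b<len seg stuckˡ stuckʳ = record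
    { start≤end = <⇒≤ a<b ; end<length = b<len ; mono = d , seg ; maximal = maximal′ }
    where
    maximal′ : ∀ {a′ b′} → b′ < length ys → a′ ≤ a → b ≤ b′ → Mono ys a′ b′ → a′ ≡ a × b′ ≡ b
    maximal′ {a′} {b′} b′<len a′≤a b≤b′ (e , seg′)
      with refl ← step-dir-unique (seg a ≤-refl a<b) (seg′ a a′≤a (<-≤-trans a<b b≤b′)) = start , end
      where
      start : a′ ≡ a
      start with m≤n⇒m<n∨m≡n a′≤a
      ... | inj₂ a′≡a = a′≡a
      ... | inj₁ a′<a with s , s+1≡a , a′≤s ← <⇒≡suc a′<a =
        ⊥-elim (stuckˡ s+1≡a (seg′ s a′≤s (<-≤-trans (≤-reflexive s+1≡a) (≤-trans (<⇒≤ a<b) b≤b′))))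
      end : b′ ≡ b
      end with m≤n⇒m<n∨m≡n b≤b′
      ... | inj₂ b≡b′ = sym b≡b′
      ... | inj₁ b<b′ = ⊥-elim (stuckʳ (≤-<-trans b<b′ b′<len) (seg′ b (≤-trans a′≤a (<⇒≤ a<b)) b<b′))

  run-stuckˡ : ∀ {d ys a b t} → Run ys a b → Seg d ys a b → suc t ≡ a → ¬ Step d ys t
  run-stuckˡ {d} {t = t} R seg refl st =
    1+n≢n (sym (proj₁ (Run.maximal R (Run.end<length R) (n≤1+n t) ≤-refl (d , seg-stepˡ st seg))))

  run-stuckʳ : ∀ {d ys a b} → Run ys a b → Seg d ys a b → suc b < length ys → ¬ Step d ys b
  run-stuckʳ {d} {b = b} R seg sb<len st =
    1+n≢n (proj₂ (Run.maximal R sb<len ≤-refl (n≤1+n b) (d , seg-stepʳ seg st)))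

  run-start≤ : ∀ {e ys a b t} → Run ys a b → Step e ys t → suc t ≡ b → a ≤ t
  run-start≤ {e} {a = a} {t = t} R st refl with a ≤? t
  ... | yes a≤t = a≤t
  ... | no  a≰t = ⊥-elim (1+n≢n (sym (trans t≡a a≡st)))
    where
    t≡a = proj₁ (Run.maximal R (Run.end<length R) (<⇒≤ (≰⇒> a≰t)) ≤-refl (e , seg-single st))
    a≡st = ≤-antisym (Run.start≤end R) (≰⇒> a≰t)

  run-absorbs : ∀ {e ys a b a′ b′ t} → Run ys a b → Seg e ys a′ b′ → b′ < length ys →
    a ≤ t → t < b → a′ ≤ t → t < b′ → a ≤ a′ × b′ ≤ b
  run-absorbs {e} {a = a} {b} {a′} {b′} {t} R seg′ b′<len a≤t t<b a′≤t t<b′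
    with d , seg ← Run.mono R
    with refl ← step-dir-unique (seg t a≤t t<b) (seg′ t a′≤t t<b′) = start , end
    where
    start : a ≤ a′
    start with a ≤? a′
    ... | yes a≤a′ = a≤a′
    ... | no  a≰a′ with s , s+1≡a , a′≤s ← <⇒≡suc (≰⇒> a≰a′) =
      ⊥-elim (run-stuckˡ R seg s+1≡a (seg′ s a′≤s (<-trans (≤-trans (≤-reflexive s+1≡a) a≤t) t<b′)))
    end : b′ ≤ b
    end with b′ ≤? b
    ... | yes b′≤b = b′≤b
    ... | no  b′≰b = ⊥-elim (run-stuckʳ R seg (≤-<-trans (≰⇒> b′≰b) b′<len)
                               (seg′ b (≤-trans a′≤t (<⇒≤ t<b)) (≰⇒> b′≰b)))

  runs-coincide : ∀ {ys a b a′ b′ t} → Run ys a b → Run ys a′ b′ →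
    a ≤ t → t < b → a′ ≤ t → t < b′ → a ≡ a′ × b ≡ b′
  runs-coincide R R′ a≤t t<b a′≤t t<b′
    with _ , seg ← Run.mono R | _ , seg′ ← Run.mono R′
    with a≤a′ , b′≤b ← run-absorbs R seg′ (Run.end<length R′) a≤t t<b a′≤t t<b′
       | a′≤a , b≤b′ ← run-absorbs R′ seg (Run.end<length R) a′≤t t<b′ a≤t t<b
    = ≤-antisym a≤a′ a′≤a , ≤-antisym b≤b′ b′≤b

  run-long-via : ∀ {ys a b a′ b′ t} → Run ys a b → Run ys a′ b′ →
    a ≤ t → t < b → a′ ≤ t → t < b′ → k ≤ suc (b′ ∸ a′) → k ≤ suc (b ∸ a)
  run-long-via R R′ a≤t t<b a′≤t t<b′ long
    with refl , refl ← runs-coincide R R′ a≤t t<b a′≤t t<b′ = long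

  monotone-tail : ∀ {d s zs} → Monotone d (s ∷ zs) → Monotone d zs
  monotone-tail mono t _ t< = step-cong refl refl (mono (suc t) z≤n (<∸1⇒suc< t<))

  monotone-run : ∀ {d zs} → Monotone d zs → 0 < length zs → Run zs 0 (length zs ∸ 1)
  monotone-run {d} mono 0<n = record
    { start≤end  = z≤n
    ; end<length = ∸1< 0<n
    ; mono       = d , mono
    ; maximal    = λ b′<n a′≤0 n∸1≤b′ _ → n≤0⇒n≡0 a′≤0 , ≤-antisym (<⇒≤pred b′<n) n∸1≤b′
    }

  monotone-rollercoaster : ∀ {d zs} → Monotone d zs → k ≤ length zs → Rollercoaster zs
  monotone-rollercoaster {d} {zs} mono k≤n {a} {b} R
    with 0<n ← ≤-<-trans z≤n (Run.end<length R)
    with refl , refl ← Run.maximal R (∸1< 0<n) z≤n (<⇒≤pred (Run.end<length R)) (d , mono)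
    = subst (k ≤_) (sym (suc-∸1 0<n)) k≤n

  record Prefix (s W : List A) : Set o where
    field
      length≤ : length s ≤ length W
      agree   : ∀ {i} → i < length s → s ‼ i ≡ W ‼ i

  take-prefix : ∀ m W → Prefix (take m W) W
  take-prefix m W = record
    { length≤ = ≤-trans (≤-reflexive (length-take m W)) (m⊓n≤n m (length W))
    ; agree   = λ i< → ‼-take m W (<-≤-trans i< (≤-trans (≤-reflexive (length-take m W)) (m⊓n≤m m (length W))))
    }

  ++-prefix : ∀ xs ys → Prefix xs (xs ++ ys)
  ++-prefix xs ys = record
    { length≤ = ≤-trans (m≤m+n (length xs) (length ys)) (≤-reflexive (sym (length-++ xs)))
    ; agree   = λ i< → sym (‼-++ˡ xs ys i<)
    }

  module _ {s W} (pre : Prefix s W) where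
    open Prefix pre

    step-prefix⁺ : ∀ {d t} → suc t < length s → Step d s t → Step d W t
    step-prefix⁺ st< = step-cong (agree (<-trans (n<1+n _) st<)) (agree st<)

    step-prefix⁻ : ∀ {d t} → suc t < length s → Step d W t → Step d s t
    step-prefix⁻ st< = step-cong (sym (agree (<-trans (n<1+n _) st<))) (sym (agree st<))

    seg-prefix⁺ : ∀ {d a b} → b < length s → Seg d s a b → Seg d W a b
    seg-prefix⁺ b< seg t a≤t t<b = step-prefix⁺ (≤-<-trans t<b b<) (seg t a≤t t<b)

    seg-prefix⁻ : ∀ {d a b} → b < length s → Seg d W a b → Seg d s a b
    seg-prefix⁻ b< seg t a≤t t<b = step-prefix⁻ (≤-<-trans t<b b<) (seg t a≤t t<b)

    run-restrict : ∀ {a b} → Run W a b → b < length s → Run s a b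
    run-restrict R b< = record
      { start≤end  = Run.start≤end R
      ; end<length = b<
      ; mono       = let d , seg = Run.mono R in d , seg-prefix⁻ b< seg
      ; maximal    = λ b′< a′≤a b≤b′ (e , seg′) →
          Run.maximal R (<-≤-trans b′< length≤) a′≤a b≤b′ (e , seg-prefix⁺ b′< seg′)
      }

    run-extend : ∀ {a b} → Run s a b → suc b < length s → Run W a b
    run-extend {a} {b} R sb< = record
      { start≤end  = Run.start≤end R
      ; end<length = <-≤-trans (<-trans (n<1+n b) sb<) length≤
      ; mono       = let d , seg = Run.mono R in d , seg-prefix⁺ (<-trans (n<1+n b) sb<) seg
      ; maximal    = maximal′
      }
      where
      maximal′ : ∀ {a′ b′} → b′ < length W → a′ ≤ a → b ≤ b′ → Mono W a′ b′ → a′ ≡ a × b′ ≡ b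
      maximal′ {a′} {b′} b′< a′≤a b≤b′ (e , seg′) with b′ <? length s
      ... | yes b′<s = Run.maximal R b′<s a′≤a b≤b′ (e , seg-prefix⁻ b′<s seg′)
      ... | no  b′≮s = ⊥-elim (1+n≢n (proj₂ (Run.maximal R sb< a′≤a (n≤1+n b)
                         (e , seg-prefix⁻ sb< (seg-shrink seg′ ≤-refl (<⇒≤ (<-≤-trans sb< (≮⇒≥ b′≮s))))))))

  step-++ʳ : ∀ xs {d ys u} → Step d ys u → Step d (xs ++ ys) (length xs + u)
  step-++ʳ xs {ys = ys} {u} = step-cong (sym (‼-++ʳ xs ys u))
    (trans (sym (‼-++ʳ xs ys (suc u))) (cong ((xs ++ ys) ‼_) (+-suc (length xs) u)))

  seg-++ʳ : ∀ xs {d ys a b} → Seg d ys a b → Seg d (xs ++ ys) (length xs + a) (length xs + b)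
  seg-++ʳ xs {a = a} {b} seg t m+a≤t t<m+b
    with u , refl ← m≤n⇒∃[o]m+o≡n (≤-trans (m≤m+n (length xs) a) m+a≤t)
    = step-++ʳ xs (seg u (+-cancelˡ-≤ (length xs) a u m+a≤t) (+-cancelˡ-< (length xs) u b t<m+b))

  step-drop : ∀ p {d ys t} → Step d ys (p + t) → Step d (drop p ys) t
  step-drop p {ys = ys} {t} = step-cong (sym (‼-drop p ys t))
    (trans (cong (ys ‼_) (sym (+-suc p t))) (sym (‼-drop p ys (suc t))))

  seg-drop : ∀ p {d ys a b} → Seg d ys (p + a) (p + b) → Seg d (drop p ys) a b
  seg-drop p seg t a≤t t<b = step-drop p (seg (p + t) (+-monoʳ-≤ p a≤t) (+-monoʳ-< p t<b))

  module Concatenation (2≤k : 2 ≤ k) {d ys zs} (rc : Rollercoaster ys) (last : LastRun (opposite d) ys)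
                       (zs-mono : Monotone d zs) (1≤L : 1 ≤ length zs) where
    W = ys ++ zs
    m = length ys
    L = length zs
    j = m ∸ 1
    e = m + (L ∸ 1)
    p = proj₁ last
    Rp = proj₁ (proj₂ last)
    segp = proj₂ (proj₂ last)

    j<m : j < m
    j<m = Run.end<length Rp

    suc-j : suc j ≡ m
    suc-j = suc-∸1 (≤-<-trans z≤n j<m)

    p<j : p < j
    p<j = 0<∸⇒< (≤-pred (≤-trans 2≤k (rc Rp)))

    e≡ : length W ∸ 1 ≡ e
    e≡ = trans (cong (_∸ 1) (length-++ ys)) (+-∸-assoc m 1≤L)

    suc-e : suc e ≡ length W
    suc-e = trans (cong suc (sym e≡)) (suc-∸1 (<-≤-trans (≤-<-trans z≤n j<m) (Prefix.length≤ (++-prefix ys zs))))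

    e<N : e < length W
    e<N = ≤-reflexive suc-e

    e∸m : e ∸ m ≡ L ∸ 1
    e∸m = m+n∸m≡n m (L ∸ 1)

    e∸j : e ∸ j ≡ L
    e∸j = begin
      e ∸ j                    ≡⟨ cong (λ x → x + (L ∸ 1) ∸ j) (sym suc-j) ⟩
      suc j + (L ∸ 1) ∸ j      ≡⟨ cong (_∸ j) (sym (+-suc j (L ∸ 1))) ⟩
      j + suc (L ∸ 1) ∸ j      ≡⟨ m+n∸m≡n j (suc (L ∸ 1)) ⟩
      suc (L ∸ 1)              ≡⟨ suc-∸1 1≤L ⟩
      L                        ∎
      where open ≡-Reasoning

    segW : Seg d W m e
    segW = subst (λ x → Seg d W x e) (+-identityʳ m) (seg-++ʳ ys zs-mono)

    segpW : Seg (opposite d) W p j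
    segpW = seg-prefix⁺ (++-prefix ys zs) j<m segp

    stuckp : ∀ {t} → suc t ≡ p → ¬ Step (opposite d) W t
    stuckp st≡p st = run-stuckˡ Rp segp st≡p
      (step-prefix⁻ (++-prefix ys zs) (subst (_< m) (sym st≡p) (<-trans p<j j<m)) st)

    end-stuck : ∀ {e′} → suc e < length W → ¬ Step e′ W e
    end-stuck se<N = ⊥-elim (<-irrefl suc-e se<N)

    rc-from-tail : (∀ {a b} → Run W a b → m ≤ b → k ≤ suc (b ∸ a)) → Rollercoaster W
    rc-from-tail long {a} {b} R with b <? m
    ... | yes b<m = rc (run-restrict (++-prefix ys zs) R b<m)
    ... | no  b≮m = long R (≮⇒≥ b≮m)

    tail-step : ∀ {b} → m ≤ b → b < length W → ∃[ t ] suc t ≡ b × j ≤ t × t < e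
    tail-step m≤b b<N with t , st≡b , j≤t ← <⇒≡suc (<-≤-trans j<m m≤b) =
      t , st≡b , j≤t , ≤-pred (subst (suc t <_) (sym suc-e) (subst (_< length W) (sym st≡b) b<N))

    -- The runs of W reaching into zs are [p, m], the last run of ys prolonged by the junction, and [m, e].
    turn : Step (opposite d) W j → k ≤ L → Rollercoaster W × LastRun d W
    turn junction k≤L = rc-from-tail long , m , subst (Run W m) (sym e≡) R₂ , subst (Seg d W m) (sym e≡) segW
      where
      m<e : m < e
      m<e = subst (_< e) (+-identityʳ m) (+-monoʳ-< m (∸-monoˡ-< {1} {1} (≤-trans 2≤k k≤L) ≤-refl))
      R₁ : Run W p m
      R₁ = run-intro (<-trans p<j j<m) (<-trans m<e e<N)
             (subst (Seg (opposite d) W p) suc-j (seg-stepʳ segpW junction))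
             stuckp (λ _ → step-asym (segW m ≤-refl m<e))
      R₂ : Run W m e
      R₂ = run-intro m<e e<N segW
             (λ st≡m → step-asymʳ (subst (Step (opposite d) W) (suc-injective (trans suc-j (sym st≡m))) junction))
             end-stuck
      long : ∀ {a b} → Run W a b → m ≤ b → k ≤ suc (b ∸ a)
      long R m≤b with tail-step m≤b (Run.end<length R)
      ... | t , refl , j≤t , t<e with m≤n⇒m<n∨m≡n j≤t
      ...   | inj₂ refl = run-long-via R R₁ (run-start≤ R junction refl) (n<1+n j) (<⇒≤ p<j) j<m
                            (≤-trans (rc Rp) (s≤s (∸-monoˡ-≤ p (<⇒≤ j<m))))
      ...   | inj₁ j<t  = run-long-via R R₂ (run-start≤ R (segW t m≤t t<e) refl) (n<1+n t) m≤t t<e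
                            (subst (k ≤_) (sym (trans (cong suc e∸m) (suc-∸1 1≤L))) k≤L)
        where m≤t = subst (_≤ t) suc-j j<t

    -- The junction starts the run of zs one position early: the only run of W reaching into zs is [j, e].
    continue : Step d W j → k ≤ suc L → Rollercoaster W × LastRun d W
    continue junction k≤sL = rc-from-tail long , j , subst (Run W j) (sym e≡) R₃ , subst (Seg d W j) (sym e≡) seg₃
      where
      seg₃ : Seg d W j e
      seg₃ = seg-stepˡ junction (subst (λ x → Seg d W x e) (sym suc-j) segW)
      R₃ : Run W j e
      R₃ = run-intro (<-≤-trans j<m (m≤m+n m (L ∸ 1))) e<N seg₃
             (λ {t} st≡j → step-asymʳ (segpW t (≤-pred (subst (p <_) (sym st≡j) p<j)) (subst (t <_) st≡j ≤-refl)))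
             end-stuck
      long : ∀ {a b} → Run W a b → m ≤ b → k ≤ suc (b ∸ a)
      long R m≤b with t , refl , j≤t , t<e ← tail-step m≤b (Run.end<length R) =
        run-long-via R R₃ (run-start≤ R (seg₃ t j≤t t<e) refl) (n<1+n t) j≤t t<e
          (subst (k ≤_) (sym (cong suc e∸j)) k≤sL)

  glue-turn : 2 ≤ k → ∀ {d ys zs} → Rollercoaster ys → LastRun (opposite d) ys → Monotone d zs →
    Step (opposite d) (ys ++ zs) (length ys ∸ 1) → k ≤ length zs → Rollercoaster (ys ++ zs) × LastRun d (ys ++ zs)
  glue-turn 2≤k rc last mono junction k≤L =
    Concatenation.turn 2≤k rc last mono (≤-trans (≤-trans (s≤s z≤n) 2≤k) k≤L) junction k≤L

  glue-continue : 2 ≤ k → ∀ {d ys zs} → Rollercoaster ys → LastRun (opposite d) ys → Monotone d zs →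
    Step d (ys ++ zs) (length ys ∸ 1) → k ≤ suc (length zs) → Rollercoaster (ys ++ zs) × LastRun d (ys ++ zs)
  glue-continue 2≤k rc last mono junction k≤sL =
    Concatenation.continue 2≤k rc last mono (≤-pred (≤-trans 2≤k k≤sL)) junction k≤sL

  -- Runs of the prefix ending before p are runs of ys; the one ending at p shares its last step with [q, p].
  rollercoaster-take : ∀ {ys q p} → Rollercoaster ys → Run ys q p → q < p → Rollercoaster (take (suc p) ys)
  rollercoaster-take {ys} {q} rc Rq q<p {a} {b} R
    with p₀ , refl , q≤p₀ ← <⇒≡suc q<p
    with len ← length-take-≤ ys (Run.end<length Rq)
    with m≤n⇒m<n∨m≡n (≤-pred (subst (b <_) len (Run.end<length R)))
  ... | inj₁ b<p  = rc (run-extend (take-prefix _ ys) R (subst (suc b <_) (sym len) (s≤s b<p)))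
  ... | inj₂ refl = run-long-via R Rq′ (run-start≤ R (last-step (proj₂ (Run.mono Rq))) refl)
                      (n<1+n p₀) q≤p₀ (n<1+n p₀) (rc Rq)
    where
    p<s = subst (suc p₀ <_) (sym len) ≤-refl
    Rq′ = run-restrict (take-prefix _ ys) Rq p<s
    last-step : ∀ {e} → Seg e ys q (suc p₀) → Step e (take (suc (suc p₀)) ys) p₀
    last-step seg = step-prefix⁻ (take-prefix _ ys) p<s (seg p₀ q≤p₀ (n<1+n p₀))

  Adjacent : List A → Set o
  Adjacent ys = ∀ {t} → suc t < length ys → Step ↑ ys t ⊎ Step ↓ ys t

  adjacent-opposite : ∀ {d ys t} → Adjacent ys → suc t < length ys → ¬ Step d ys t → Step (opposite d) ys t
  adjacent-opposite {↑} adj st< ¬up with adj st<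
  ... | inj₁ up′ = ⊥-elim (¬up up′)
  ... | inj₂ dn  = dn
  adjacent-opposite {↓} adj st< ¬dn with adj st<
  ... | inj₁ up′ = up′
  ... | inj₂ dn  = ⊥-elim (¬dn dn)

  adjacent-unique : ∀ {ys} → Unique (StrictTotalOrder.Eq.setoid O) ys → Adjacent ys
  adjacent-unique {u ∷ v ∷ _} ((u≉v ∷ _) ∷ _) {zero} _ with compare u v
  ... | tri< u<v _   _   = inj₁ (up (fromWitness u<v))
  ... | tri≈ _   u≈v _   = ⊥-elim (u≉v u≈v)
  ... | tri> _   _   v<u = inj₂ (down (fromWitness v<u))
  adjacent-unique {_ ∷ _} (_ ∷ uniq) {suc t} (s≤s st<) with adjacent-unique uniq st<
  ... | inj₁ s = inj₁ (step-cong refl refl s)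
  ... | inj₂ s = inj₂ (step-cong refl refl s)

  -- A last run [p, n-1] with p > 0 is preceded, by adjacency, by a run of the opposite direction ending at p.
  split-last-run : 2 ≤ k → ∀ {d ys} → Adjacent ys → Rollercoaster ys → LastRun d ys →
    (Monotone d ys × k ≤ length ys) ⊎
    (∃[ p ] p < length ys × Rollercoaster (take (suc p) ys) × LastRun (opposite d) (take (suc p) ys)
                          × Monotone d (drop p ys) × k ≤ length ys ∸ p)
  split-last-run 2≤k adj rc (zero , R , seg) =
    inj₁ (seg , subst (k ≤_) (suc-∸1 (≤-<-trans z≤n (Run.end<length R))) (rc R))
  split-last-run 2≤k {d} {ys} adj rc (suc p₀ , R , seg) =
    inj₂ (p , p<n , rollercoaster-take rc Rq q<p , last-prefix , seg-drop p seg-tail , k≤n∸p)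
    where
    n = length ys
    p = suc p₀
    0<n = ≤-<-trans z≤n (Run.end<length R)
    p<n∸1 : p < n ∸ 1
    p<n∸1 = 0<∸⇒< (≤-pred (≤-trans 2≤k (rc R)))
    p<n : p < n
    p<n = <-trans p<n∸1 (∸1< 0<n)
    k≤n∸p : k ≤ n ∸ p
    k≤n∸p = subst (k ≤_) (trans (cong suc (∸-+-assoc n 1 p)) (sym (+-∸-assoc 1 p<n))) (rc R)
    turning : Step (opposite d) ys p₀
    turning = adjacent-opposite adj p<n (run-stuckˡ R seg refl)
    extended = seg-extendˡ (opposite d) p₀ (seg-single turning)
    q = proj₁ extended
    q<p : q < p
    q<p = s≤s (proj₁ (proj₂ extended))
    seg-q : Seg (opposite d) ys q p
    seg-q = proj₁ (proj₂ (proj₂ extended))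
    Rq : Run ys q p
    Rq = run-intro q<p p<n seg-q (proj₂ (proj₂ (proj₂ extended))) (λ _ → step-asym (seg p ≤-refl p<n∸1))
    end≡ : p ≡ length (take (suc p) ys) ∸ 1
    end≡ = cong (_∸ 1) (sym (length-take-≤ ys p<n))
    last-prefix : LastRun (opposite d) (take (suc p) ys)
    last-prefix = q , subst (Run _ q) end≡ (run-restrict pre Rq p<s)
                    , subst (Seg _ _ q) end≡ (seg-prefix⁻ pre p<s seg-q)
      where
      pre = take-prefix (suc p) ys
      p<s = subst (p <_) (sym (length-take-≤ ys p<n)) ≤-refl
    seg-tail : Seg d ys (p + 0) (p + (length (drop p ys) ∸ 1))
    seg-tail = subst₂ (Seg d ys) (sym (+-identityʳ p)) end-eq seg
      where
      end-eq : n ∸ 1 ≡ p + (length (drop p ys) ∸ 1)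
      end-eq = begin
        n ∸ 1                ≡⟨ cong (_∸ 1) (sym (m+[n∸m]≡n (<⇒≤ p<n))) ⟩
        p + (n ∸ p) ∸ 1      ≡⟨ +-∸-assoc p (m<n⇒0<n∸m p<n) ⟩
        p + (n ∸ p ∸ 1)      ≡⟨ cong (λ l → p + (l ∸ 1)) (sym (length-drop p ys)) ⟩
        p + (length (drop p ys) ∸ 1) ∎
        where open ≡-Reasoning

  seg⇔ : ∀ d {ys a b} → T (all (stepᵇ d ys) (range a b)) ⇔ Seg d ys a b
  seg⇔ d {ys} = mk⇔
    (λ h t a≤t t<b → to (step⇔ d) (to (all-range⇔ (stepᵇ d ys)) h t a≤t t<b))
    (λ seg → from (all-range⇔ (stepᵇ d ys)) λ t a≤t t<b → from (step⇔ d) (seg t a≤t t<b))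

  mono⇔ : ∀ {ys a b} → T (monoSeg ys a b) ⇔ Mono ys a b
  mono⇔ {ys} {a} {b} = mk⇔ to′ from′
    where
    to′ : T (monoSeg ys a b) → Mono ys a b
    to′ h with to (T-∨ {incSeg ys a b}) h
    ... | inj₁ inc = ↑ , to (seg⇔ ↑) inc
    ... | inj₂ dec = ↓ , to (seg⇔ ↓) dec
    from′ : Mono ys a b → T (monoSeg ys a b)
    from′ (↑ , seg) = from T-∨ (inj₁ (from (seg⇔ ↑) seg))
    from′ (↓ , seg) = from (T-∨ {incSeg ys a b}) (inj₂ (from (seg⇔ ↓) seg))

  run⇔ : ∀ ys a b → T (isRun ys a b) ⇔ Run ys a b
  run⇔ ys a b = mk⇔ to′ from′
    where
    n = length ys
    extension : ℕ → ℕ → Bool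
    extension a′ b′ = (a′ ≤ᵇ a) ∧ (b ≤ᵇ b′) ∧ monoSeg ys a′ b′

    to′ : T (isRun ys a b) → Run ys a b
    to′ h =
      let a≤ᵇb , h′   = to T-∧ h
          b<ᵇn , h″   = to (T-∧ {b <ᵇ n}) h′
          monoᵇ , maxᵇ = to (T-∧ {monoSeg ys a b}) h″
          a<n         = ≤-<-trans (≤ᵇ⇒≤ a b a≤ᵇb) (<ᵇ⇒< b n b<ᵇn)
      in record
      { start≤end  = ≤ᵇ⇒≤ a b a≤ᵇb
      ; end<length = <ᵇ⇒< b n b<ᵇn
      ; mono       = to mono⇔ monoᵇ
      ; maximal    = λ {a′} {b′} b′<n a′≤a b≤b′ mono′ →
          let a′≡ᵇa , b′≡ᵇb = to T-∧ (to (T-→ {extension a′ b′})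
                                (to (all-upTo⇔ _ {n}) (to (all-upTo⇔ _ {n}) maxᵇ a′ (≤-<-trans a′≤a a<n)) b′ b′<n)
                                (from T-∧ (≤⇒≤ᵇ a′≤a , from T-∧ (≤⇒≤ᵇ b≤b′ , from mono⇔ mono′))))
          in ≡ᵇ⇒≡ a′ a a′≡ᵇa , ≡ᵇ⇒≡ b′ b b′≡ᵇb
      }

    from′ : Run ys a b → T (isRun ys a b)
    from′ R = from T-∧ (≤⇒≤ᵇ (Run.start≤end R) , from T-∧ (<⇒<ᵇ (Run.end<length R) ,
      from T-∧ (from mono⇔ (Run.mono R) , from (all-upTo⇔ _ {n}) λ a′ _ → from (all-upTo⇔ _ {n}) λ b′ b′<n →
        from (T-→ {extension a′ b′}) λ ext →
          let a′≤ᵇa , ext′     = to T-∧ ext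
              b≤ᵇb′ , monoᵇ′ = to (T-∧ {b ≤ᵇ b′}) ext′
              a′≡a , b′≡b    = Run.maximal R b′<n (≤ᵇ⇒≤ a′ a a′≤ᵇa) (≤ᵇ⇒≤ b b′ b≤ᵇb′) (to mono⇔ monoᵇ′)
          in from T-∧ (≡⇒≡ᵇ a′ a a′≡a , ≡⇒≡ᵇ b′ b b′≡b))))

  rollercoaster⇔ : ∀ {ys} → T (rollercoaster ys) ⇔ Rollercoaster ys
  rollercoaster⇔ {ys} = mk⇔
    (λ h {a} {b} R →
      let b<n = Run.end<length R
          a<n = ≤-<-trans (Run.start≤end R) b<n
      in ≤ᵇ⇒≤ k (suc (b ∸ a)) (to (T-→ {isRun ys a b})
           (to (all-upTo⇔ _ {n}) (to (all-upTo⇔ _ {n}) h a a<n) b b<n) (from (run⇔ ys a b) R)))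
    (λ rc → from (all-upTo⇔ _ {n}) λ a _ → from (all-upTo⇔ _ {n}) λ b _ →
      from (T-→ {isRun ys a b}) λ r → ≤⇒≤ᵇ (rc (to (run⇔ ys a b) r)))
    where n = length ys

  lastRun⇔ : ∀ d {ys} →
    T (any (λ a → isRun ys a (length ys ∸ 1) ∧ all (stepᵇ d ys) (range a (length ys ∸ 1))) (upTo (length ys)))
      ⇔ LastRun d ys
  lastRun⇔ d {ys} = mk⇔
    (λ h → let a , _ , runᵇ∧segᵇ = to (any-upTo⇔ lastᵇ {n}) h
               runᵇ , segᵇ = to (T-∧ {isRun ys a (n ∸ 1)}) runᵇ∧segᵇ
           in a , to (run⇔ ys a (n ∸ 1)) runᵇ , to (seg⇔ d) segᵇ)
    (λ (a , R , seg) → from (any-upTo⇔ lastᵇ {n}) (a , ≤-<-trans (Run.start≤end R) (Run.end<length R) ,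
      from T-∧ (from (run⇔ ys a (n ∸ 1)) R , from (seg⇔ d) seg)))
    where
    n = length ys
    lastᵇ : ℕ → Bool
    lastᵇ a = isRun ys a (n ∸ 1) ∧ all (stepᵇ d ys) (range a (n ∸ 1))

  longest-≥ : ∀ (p : List A → Bool) {ys xs} → ys ⊆ xs → T (p ys) → length ys ≤ longest p xs
  longest-≥ p σ = longestAmong-≥ p _ (⊆⇒∈-sublists σ)

  longest-attained : ∀ (p : List A → Bool) xs → 0 < longest p xs →
    ∃[ ys ] ys ⊆ xs × T (p ys) × length ys ≡ longest p xs
  longest-attained p xs pos with ys , ys∈ , pys , len ← longestAmong-attained p (sublists xs) pos =
    ys , ∈-sublists⇒⊆ xs ys∈ , pys , len

module Bounds {o ℓ₁ ℓ₂} (O : StrictTotalOrder o ℓ₁ ℓ₂) (k : ℕ) (3≤k : 3 ≤ k)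
  (S : List (StrictTotalOrder.Carrier O)) (uniq : Unique (StrictTotalOrder.Eq.setoid O) S)
  (x : ℕ) (1≤x : 1 ≤ x) (x≤n : x ≤ length S) where

  open Seq O k
  open Runs O k

  -- Case distinctions on goals mentioning inc or dec are passed in as Dec arguments or let-bound:
  -- a `with` there can make Agda normalise these folds over all subsequences, which exhausts memory.

  Sx = take x S
  I = inc S x

  2≤k : 2 ≤ k
  2≤k = ≤-trans (n≤1+n 2) 3≤k

  1≤k : 1 ≤ k
  1≤k = ≤-trans (n≤1+n 1) 2≤k

  adjacent : ∀ {ys} → ys ⊆ Sx → Adjacent ys
  adjacent σ = adjacent-unique (AllPairs-resp-⊆ (⊆-trans σ (take-⊆ x S)) uniq)

  take-Sx : ∀ {i} → i ≤ x → take i Sx ≡ take i S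
  take-Sx {i} i≤x = trans (take-take i x S) (cong (λ j → take j S) (m≤n⇒m⊓n≡m i≤x))

  inc-≥ : ∀ {ys} → ys ⊆ Sx → Rollercoaster ys → LastRun ↑ ys → length ys ≤ I
  inc-≥ σ rc last = longest-≥ _ σ (from T-∧ (from rollercoaster⇔ rc , from (lastRun⇔ ↑) last))

  inc-attained : 0 < I → ∃[ ys ] ys ⊆ Sx × Rollercoaster ys × LastRun ↑ ys × length ys ≡ I
  inc-attained pos with ys , σ , rc∧last , len ← longest-attained _ Sx pos =
    let rc , last = to (T-∧ {rollercoaster ys}) rc∧last
    in ys , σ , to rollercoaster⇔ rc , to (lastRun⇔ ↑) last , len

  dec-≥ : ∀ i {ys} → ys ⊆ take i S → Rollercoaster ys → LastRun ↓ ys → length ys ≤ dec S i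
  dec-≥ i σ rc last = longest-≥ _ σ (from T-∧ (from rollercoaster⇔ rc , from (lastRun⇔ ↓) last))

  dec-attained : ∀ i → 0 < dec S i → ∃[ ys ] ys ⊆ take i S × Rollercoaster ys × LastRun ↓ ys × length ys ≡ dec S i
  dec-attained i pos with ys , σ , rc∧last , len ← longest-attained _ (take i S) pos =
    let rc , last = to (T-∧ {rollercoaster ys}) rc∧last
    in ys , σ , to rollercoaster⇔ rc , to (lastRun⇔ ↓) last , len

  LIS-≥ : ∀ {zs xs} → zs ⊆ xs → Monotone ↑ zs → length zs ≤ LIS xs
  LIS-≥ σ mono = longest-≥ increasing σ (from (seg⇔ ↑) mono)

  LIS-attained : ∀ xs → 0 < LIS xs → ∃[ zs ] zs ⊆ xs × Monotone ↑ zs × length zs ≡ LIS xs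
  LIS-attained xs pos with zs , σ , incr , len ← longest-attained increasing xs pos =
    zs , σ , to (seg⇔ ↑) incr , len

  monotone-≤-inc : ∀ {zs} → zs ⊆ Sx → Monotone ↑ zs → k ≤ length zs → length zs ≤ I
  monotone-≤-inc σ mono k≤n =
    inc-≥ σ (monotone-rollercoaster mono k≤n) (0 , monotone-run mono (≤-trans 1≤k k≤n) , mono)

  LIS-≤-inc : ∀ {xs} → xs ⊆ Sx → k ≤ LIS xs → LIS xs ≤ I
  LIS-≤-inc {xs} σ k≤L =
    let zs , τ , mono , len = LIS-attained xs (≤-trans 1≤k k≤L)
    in subst (_≤ I) len (monotone-≤-inc (⊆-trans τ σ) mono (subst (k ≤_) (sym len) k≤L))

  lis : ℕ → ℕ
  lis i = LIS (drop i Sx)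

  M'≡ : ∀ {i} → i < x → M' S i x ≡ (if lis i ≤ᵇ (k ∸ 1) then -∞ else fin (+ lis i))
  M'≡ {i} i<x = cong₂ (λ v c → if v ≤ℤᵇ c then -∞ else fin v) M≡ threshold
    where
    M≡ : M S i x ≡ + lis i
    M≡ with i <ᵇ x | <⇒<ᵇ i<x
    ... | true | _ = refl
    threshold : + k -ℤ + 1 ≡ + (k ∸ 1)
    threshold = trans (ℤ.m-n≡m⊖n k 1) (ℤ.⊖-≥ 1≤k)

  M'-long : ∀ {i} → i < x → k ≤ lis i → M' S i x ≡ fin (+ lis i)
  M'-long {i} i<x k≤L rewrite M'≡ i<x with lis i ≤ᵇ (k ∸ 1) | ≤ᵇ-reflects-≤ (lis i) (k ∸ 1)
  ... | false | _          = refl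
  ... | true  | ofʸ L≤k∸1 = ⊥-elim (<-irrefl refl (≤-<-trans (≤-trans k≤L L≤k∸1) (∸1< 1≤k)))

  M'-short : ∀ {i} → i < x → ¬ k ≤ lis i → M' S i x ≡ -∞
  M'-short {i} i<x k≰L rewrite M'≡ i<x with lis i ≤ᵇ (k ∸ 1) | ≤ᵇ-reflects-≤ (lis i) (k ∸ 1)
  ... | true  | _          = refl
  ... | false | ofⁿ L≰k∸1 = ⊥-elim (k≰L (subst (_≤ lis i) (suc-∸1 1≤k) (≰⇒> L≰k∸1)))

  ∈Z⁻ : ∀ {i} → i ∈ Z S 1 x → 1 ≤ i × i ≤ x × k ≤ lis (i ∸ 1)
  ∈Z⁻ i∈ with i∈range , k≤L ← ∈-filter⁻ (λ i → k ≤? lis (i ∸ 1)) i∈ =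
    let 1≤i , i<sx = ∈-range⁻ i∈range in 1≤i , ≤-pred i<sx , k≤L

  ∈Z⁺ : ∀ {i} → 1 ≤ i → i ≤ x → k ≤ lis (i ∸ 1) → i ∈ Z S 1 x
  ∈Z⁺ 1≤i i≤x k≤L = ∈-filter⁺ (λ i → k ≤? lis (i ∸ 1)) (∈-range⁺ 1≤i (s≤s i≤x)) k≤L

  term : ℕ → ℤ∞
  term i = fin (+ dec S i) ⊕ M' S (i ∸ 1) x ⊕ fin -[1+ 0 ]

  term≡ : ∀ {i} → i ∈ Z S 1 x → term i ≡ fin (+ (dec S i + lis (i ∸ 1) ∸ 1))
  term≡ {i} i∈ with 1≤i , i≤x , k≤L ← ∈Z⁻ i∈ =
    trans (cong (λ v → fin (+ dec S i) ⊕ v ⊕ fin -[1+ 0 ]) (M'-long (<-≤-trans (∸1< 1≤i) i≤x) k≤L))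
          (cong fin (ℤ.⊖-≥ (≤-trans (≤-trans 1≤k k≤L) (m≤n+m _ (dec S i)))))

  inc'-≤ : ∀ {z} → fin (+ 0) ≤∞ z → (∀ {i} → i ∈ Z S 1 x → term i ≤∞ z) → inc' S x ≤∞ z
  inc'-≤ 0≤z bound with Z S 1 x
  ... | []     = 0≤z
  ... | i ∷ is = maxList-lub term (i ∷ is) bound

  ≤-inc' : ∀ {i} → i ∈ Z S 1 x → term i ≤∞ inc' S x
  ≤-inc' i∈ with Z S 1 x
  ... | i ∷ is = maxList-upper term i∈

  0≤inc' : fin (+ 0) ≤∞ inc' S x
  0≤inc' with Z S 1 x in eq
  ... | []     = ≤∞-refl
  ... | i ∷ is = ≤∞-trans (subst (fin (+ 0) ≤∞_) (sym (term≡ i∈)) (fin≤fin (+≤+ z≤n)))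
                          (maxList-upper term {i ∷ is} (here refl))
    where i∈ = subst (i ∈_) (sym eq) (here refl)

  glued-≤-inc : ∀ r {ys zs} → ys ⊆ take (suc r) Sx → zs ⊆ drop r Sx →
    Rollercoaster ys → LastRun ↓ ys → Monotone ↑ zs → k ≤ length zs → length ys + length zs ∸ 1 ≤ I
  glued-≤-inc r {ys} {zs} τ σ rc last mono k≤L with ⊆-join Sx r τ σ
  ... | inj₁ ρ = ≤-trans (m∸n≤m _ 1) (subst (_≤ I) (length-++ ys) (inc-≥ ρ (proj₁ glued) (proj₂ glued)))
    where
    junction< : suc (length ys ∸ 1) < length (ys ++ zs)
    junction< = subst₂ _<_ (sym (suc-∸1 (≤-<-trans z≤n (Run.end<length (proj₁ (proj₂ last))))))
                      (sym (length-++ ys)) (m<m+n (length ys) (≤-trans 1≤k k≤L))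
    glued : Rollercoaster (ys ++ zs) × LastRun ↑ (ys ++ zs)
    glued with adjacent ρ junction<
    ... | inj₁ rise = glue-continue 2≤k rc last mono rise (m≤n⇒m≤1+n k≤L)
    ... | inj₂ fall = glue-turn 2≤k rc last mono fall k≤L
  ... | inj₂ (ys₀ , zs₀ , s , refl , refl , ρ) =
    subst (_≤ I) len (inc-≥ ρ (proj₁ glued) (proj₂ glued))
    where
    rise : Step ↑ ((ys₀ ++ s ∷ []) ++ zs₀) (length (ys₀ ++ s ∷ []) ∸ 1)
    rise = subst₂ (Step ↑) (sym (++-assoc ys₀ (s ∷ []) zs₀))
             (trans (+-identityʳ (length ys₀)) (sym (trans (cong (_∸ 1) (length-++ ys₀)) (m+n∸n≡m _ 1))))
             (step-++ʳ ys₀ (mono 0 z≤n (≤-pred (≤-trans 2≤k k≤L))))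
    glued = glue-continue 2≤k rc last (monotone-tail mono) rise k≤L
    len : length ((ys₀ ++ s ∷ []) ++ zs₀) ≡ length (ys₀ ++ s ∷ []) + length (s ∷ zs₀) ∸ 1
    len = trans (length-++ (ys₀ ++ s ∷ [])) (sym (cong (_∸ 1) (+-suc _ (length zs₀))))

  dec+monotone-≤-inc : ∀ {i zs} → 1 ≤ i → i ≤ x → zs ⊆ drop (i ∸ 1) Sx → Monotone ↑ zs → k ≤ length zs →
    Dec (0 < dec S i) → dec S i + length zs ∸ 1 ≤ I
  dec+monotone-≤-inc {i} {zs} _ _ σ mono k≤L (no d≯0) =
    subst (λ d → d + length zs ∸ 1 ≤ I) (sym (n≤0⇒n≡0 (≮⇒≥ d≯0)))
      (≤-trans (m∸n≤m _ 1) (monotone-≤-inc (⊆-trans σ (drop-⊆ (i ∸ 1) Sx)) mono k≤L))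
  dec+monotone-≤-inc {i} {zs} 1≤i i≤x σ mono k≤L (yes d>0) =
    let ys , τ , rc , last , len = dec-attained i d>0
        τ′ = subst (ys ⊆_) (sym (trans (cong (λ j → take j Sx) (suc-∸1 1≤i)) (take-Sx i≤x))) τ
    in subst (λ d → d + length zs ∸ 1 ≤ I) len (glued-≤-inc (i ∸ 1) τ′ σ rc last mono k≤L)

  dec+LIS-≤-inc : ∀ {i} → 1 ≤ i → i ≤ x → k ≤ lis (i ∸ 1) → dec S i + lis (i ∸ 1) ∸ 1 ≤ I
  dec+LIS-≤-inc {i} 1≤i i≤x k≤L =
    let zs , σ , mono , len = LIS-attained (drop (i ∸ 1) Sx) (≤-trans 1≤k k≤L)
    in subst (λ l → dec S i + l ∸ 1 ≤ I) len
         (dec+monotone-≤-inc 1≤i i≤x σ mono (subst (k ≤_) (sym len) k≤L) (0 <? dec S i))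

  term-≤-inc : ∀ {i} → i ∈ Z S 1 x → term i ≤∞ fin (+ I)
  term-≤-inc i∈ =
    let 1≤i , i≤x , k≤L = ∈Z⁻ i∈ in
    subst (_≤∞ fin (+ I)) (sym (term≡ i∈)) (fin≤fin (+≤+ (dec+LIS-≤-inc 1≤i i≤x k≤L)))

  inc'-≤-inc : inc' S x ≤∞ fin (+ I)
  inc'-≤-inc = inc'-≤ (fin≤fin (+≤+ z≤n)) term-≤-inc

  M'-≤-inc : Dec (k ≤ lis 0) → M' S 0 x ≤∞ fin (+ I)
  M'-≤-inc (yes k≤L) = subst (_≤∞ fin (+ I)) (sym (M'-long 1≤x k≤L)) (fin≤fin (+≤+ (LIS-≤-inc (drop-⊆ 0 Sx) k≤L)))
  M'-≤-inc (no  k≰L) = subst (_≤∞ fin (+ I)) (sym (M'-short 1≤x k≰L)) (-∞≤ _)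

  monotone-≤-M' : ∀ {ys} → ys ⊆ Sx → Monotone ↑ ys → k ≤ length ys → fin (+ length ys) ≤∞ M' S 0 x
  monotone-≤-M' σ mono k≤n =
    subst (fin (+ _) ≤∞_) (sym (M'-long 1≤x (≤-trans k≤n (LIS-≥ σ mono)))) (fin≤fin (+≤+ (LIS-≥ σ mono)))

  split-≤-inc' : ∀ {ys p} → ys ⊆ Sx → p < length ys →
    Rollercoaster (take (suc p) ys) → LastRun ↓ (take (suc p) ys) → Monotone ↑ (drop p ys) → k ≤ length ys ∸ p →
    fin (+ length ys) ≤∞ inc' S x
  split-≤-inc' {ys} {p} σ p<n rc₁ last₁ mono₂ k≤n∸p =
    ≤∞-trans (fin≤fin (+≤+ n≤term)) (subst (_≤∞ inc' S x) (term≡ i∈) (≤-inc' i∈))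
    where
    n = length ys
    split = ⊆-split σ p<n
    r = proj₁ split
    r< = proj₁ (proj₂ split)
    τ = proj₁ (proj₂ (proj₂ split))
    ρ = proj₂ (proj₂ (proj₂ split))
    sr≤x : suc r ≤ x
    sr≤x = subst (r <_) (length-take-≤ S x≤n) r<
    dec-bound : suc p ≤ dec S (suc r)
    dec-bound = subst (_≤ dec S (suc r)) (length-take-≤ ys p<n)
                  (dec-≥ (suc r) (subst (_ ⊆_) (take-Sx sr≤x) τ) rc₁ last₁)
    lis-bound : n ∸ p ≤ lis r
    lis-bound = subst (_≤ lis r) (length-drop p ys) (LIS-≥ ρ mono₂)
    i∈ : suc r ∈ Z S 1 x
    i∈ = ∈Z⁺ (s≤s z≤n) sr≤x (≤-trans k≤n∸p lis-bound)
    n≤term : n ≤ dec S (suc r) + lis r ∸ 1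
    n≤term = subst (_≤ dec S (suc r) + lis r ∸ 1) (m+[n∸m]≡n (<⇒≤ p<n)) (∸-monoˡ-≤ 1 (+-mono-≤ dec-bound lis-bound))

  split-≤-max : ∀ {ys} → ys ⊆ Sx →
    (Monotone ↑ ys × k ≤ length ys) ⊎
    (∃[ p ] p < length ys × Rollercoaster (take (suc p) ys) × LastRun ↓ (take (suc p) ys)
                          × Monotone ↑ (drop p ys) × k ≤ length ys ∸ p) →
    fin (+ length ys) ≤∞ inc' S x ⊎ fin (+ length ys) ≤∞ M' S 0 x
  split-≤-max σ (inj₁ (mono , k≤n))                          = inj₂ (monotone-≤-M' σ mono k≤n)
  split-≤-max σ (inj₂ (p , p<n , rc₁ , last₁ , mono₂ , k≤n∸p)) = inj₁ (split-≤-inc' σ p<n rc₁ last₁ mono₂ k≤n∸p)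

  inc-≤-inc'-or-M' : Dec (0 < I) → fin (+ I) ≤∞ inc' S x ⊎ fin (+ I) ≤∞ M' S 0 x
  inc-≤-inc'-or-M' (no I≯0) = inj₁ (subst (λ v → fin (+ v) ≤∞ inc' S x) (sym (n≤0⇒n≡0 (≮⇒≥ I≯0))) 0≤inc')
  inc-≤-inc'-or-M' (yes I>0) =
    let ys , σ , rc , last , len = inc-attained I>0
    in subst (λ v → fin (+ v) ≤∞ inc' S x ⊎ fin (+ v) ≤∞ M' S 0 x) len
         (split-≤-max σ (split-last-run 2≤k (adjacent σ) rc last))

proposition17 : ∀ {a ℓ₁ ℓ₂} (O : StrictTotalOrder a ℓ₁ ℓ₂) (k : ℕ) → 3 ≤ k →
    (S : List (StrictTotalOrder.Carrier O)) →
    Unique (StrictTotalOrder.Eq.setoid O) S →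
    (x : ℕ) → 1 ≤ x → x ≤ length S →
    fin (+ Seq.inc O k S x) ≡ max∞ (Seq.inc' O k S x) (Seq.M' O k S 0 x)
proposition17 O k 3≤k S uniq x 1≤x x≤n =
  ≤∞-antisym (≤-max∞ (inc-≤-inc'-or-M' (0 <? I))) (max∞-lub inc'-≤-inc (M'-≤-inc (k ≤? lis 0)))
  where open Bounds O k 3≤k S uniq x 1≤x x≤n
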